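{- Let $q$ be a prime power and let $\alpha$ be a projective plane $\mathrm{PG}(2,q)$ (e.g. a plane of $\mathrm{PG}(n-1,q)$). Let $\pi$ be a permutation of the points of $\alpha$ which is not a collineation of $\alpha$ (i.e. $\pi\notin\mathrm{P\Gamma L}(\alpha)$). Then there exist at least three lines $\ell$ of $\alpha$, not all passing through a common point, such that the image $\pi(\ell)$ of the point set of $\ell$ is not a line of $\alpha$.
   Context: $\mathrm{P\Gamma L}(\alpha)$ denotes the group of collineations of the projective plane $\alpha$, acting on its points. -}

module Defs where

open import Level using (Level; 0ℓ; _⊔_) renaming (suc to lsuc)
open import Algebra.Bundles using (CommutativeRing)
open import Data.Nat using (ℕ; suc; _^_)
open import Data.Nat.Primality using (Prime)
open import Data.Product using (Σ; ∃; _×_; _,_)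
open import Relation.Nullary using (¬_)
open import Relation.Binary.PropositionalEquality using (_≡_)

IsPrimePower : ℕ → Set
IsPrimePower q = Σ ℕ λ p → Σ ℕ λ k → Prime p × q ≡ p ^ suc k

record Field (c ℓ : Level) : Set (lsuc (c ⊔ ℓ)) where
  field
    commRing : CommutativeRing c ℓ
  open CommutativeRing commRing public
  field
    0≉1     : ¬ (0# ≈ 1#)
    inverse : ∀ x → ¬ (x ≈ 0#) → ∃ λ y → (x * y) ≈ 1#

module PG {c ℓ : Level} (F : Field c ℓ) where
  open Field F

  record Vec3 : Set c where
    constructor ⟨_,_,_⟩
    field
      x₀ x₁ x₂ : Carrier
  open Vec3 public

  IsZero : Vec3 → Set ℓ
  IsZero v = (x₀ v ≈ 0#) × (x₁ v ≈ 0#) × (x₂ v ≈ 0#)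

  -- points: nonzero vectors of F^3 (taken up to nonzero scalars, see _∼_)
  Point : Set (c ⊔ ℓ)
  Point = Σ Vec3 λ v → ¬ IsZero v

  -- lines: nonzero dual vectors (also up to nonzero scalars)
  Line : Set (c ⊔ ℓ)
  Line = Point

  coords : Point → Vec3
  coords (v , _) = v

  _∼_ : Point → Point → Set (c ⊔ ℓ)
  P ∼ Q = ∃ λ a → ¬ (a ≈ 0#) ×
    ((x₀ (coords P) ≈ a * x₀ (coords Q)) ×
     (x₁ (coords P) ≈ a * x₁ (coords Q)) ×
     (x₂ (coords P) ≈ a * x₂ (coords Q)))

  _I_ : Point → Line → Set ℓ
  P I L = ((x₀ (coords L) * x₀ (coords P)) + (x₁ (coords L) * x₁ (coords P))
            + (x₂ (coords L) * x₂ (coords P))) ≈ 0#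

  record PointPerm : Set (c ⊔ ℓ) where
    field
      fun        : Point → Point
      cong       : ∀ P Q → P ∼ Q → fun P ∼ fun Q
      injective  : ∀ P Q → fun P ∼ fun Q → P ∼ Q
      surjective : ∀ Q → ∃ λ P → fun P ∼ Q
  open PointPerm public

  ImageIs : PointPerm → Line → Line → Set (c ⊔ ℓ)
  ImageIs π L M =
    (∀ P → P I L → fun π P I M) ×
    (∀ Q → Q I M → ∃ λ P → P I L × (fun π P ∼ Q))

  ImageIsLine : PointPerm → Line → Set (c ⊔ ℓ)
  ImageIsLine π L = ∃ λ M → ImageIs π L M

  IsCollineation : PointPerm → Set (c ⊔ ℓ)
  IsCollineation π = ∀ L → ImageIsLine π L

-- Call a line good if π maps it onto a line. If every line avoiding some point P is good, then so
-- is every line L through P: take Q ≠ P on L and let M be the line through π P and π Q. For Z off L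
-- the line QZ avoids P, so its image is the line through π Q and π Z; this forces π⁻¹(M) ⊆ L, and a
-- point X ∈ L with π X ∉ M would yield q + 1 points of L ∖ {P} (the preimages of the line through
-- π Q and π X), while L ∖ {P} has only q points. So if π is not a collineation, every point avoids
-- some bad line: take a bad line L₁, a point P₁ on it, a bad line L₃ avoiding P₁ and a bad line L₂
-- avoiding L₁ ∩ L₃. Since F is finite, all these properties are decidable, so the lines are found
-- by exhaustive search.
module Submission where

open import Defs
open import Level using (Level; 0ℓ; _⊔_)
open import Algebra.Bundles using (CommutativeRing)
open import Data.Nat as ℕ using (ℕ; zero; suc)
import Data.Nat.Properties as ℕ
open import Data.Fin as Fin using (Fin)
open import Data.Integer.Base as ℤ using (ℤ; +_; -[1+_]; sign; ∣_∣; _◃_)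
import Data.Integer.Properties as ℤ
open import Data.Sign.Base as Sign using (Sign)
open import Data.Maybe.Base using (Maybe; just; nothing)
open import Data.Product using (∃; _×_; _,_; proj₁; proj₂)
open import Data.Sum using (_⊎_; inj₁; inj₂)
open import Data.Empty using (⊥; ⊥-elim)
open import Relation.Binary.Definitions using (Decidable)
open import Relation.Nullary using (¬_; Dec; yes; no)
open import Relation.Nullary.Decidable using (map′; _×-dec_; _→-dec_; ¬?; decidable-stable)
open import Function.Definitions using (Injective)
import Data.Fin.Properties as Fin
open import Function.Bundles using (Inverse)
open import Relation.Binary.PropositionalEquality as ≡ using (_≡_; setoid)
open import Algebra.Solver.Ring.AlmostCommutativeRing
  using (fromCommutativeRing; _-Raw-AlmostCommutative⟶_)

-- Algebra.Solver.Ring needs coefficients whose equality computes, so we use ℤ, which maps into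
-- every commutative ring. With the optimised _×_, fromℤ (+ 0) and fromℤ (+ 1) are definitionally
-- 0# and 1#, so the solver's constants need no rewriting.
module IntegerCoefficientSolver {c ℓ : Level} (R : CommutativeRing c ℓ) where
  open CommutativeRing R
  open import Algebra.Properties.Ring ring
    using (-‿distribˡ-*; -‿distribʳ-*; -‿involutive; -0#≈0#; -‿+-comm)
  open import Algebra.Properties.Semiring.Mult.TCOptimised semiring
    using (×-homo-+; ×1-homo-*; 1+×) renaming (_×_ to _×ₙ_)
  open import Relation.Binary.Reasoning.Setoid (CommutativeRing.setoid R)

  signed : Sign → Carrier → Carrier
  signed Sign.+ x = x
  signed Sign.- x = - x

  signed-cong : ∀ s {x y} → x ≈ y → signed s x ≈ signed s y
  signed-cong Sign.+ x≈y = x≈y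
  signed-cong Sign.- x≈y = -‿cong x≈y

  signed-* : ∀ s t x y → signed (s Sign.* t) (x * y) ≈ signed s x * signed t y
  signed-* Sign.+ Sign.+ x y = refl
  signed-* Sign.+ Sign.- x y = -‿distribʳ-* x y
  signed-* Sign.- Sign.+ x y = -‿distribˡ-* x y
  signed-* Sign.- Sign.- x y = begin
    x * y         ≈⟨ -‿involutive (x * y) ⟨
    - - (x * y)   ≈⟨ -‿cong (-‿distribʳ-* x y) ⟩
    - (x * - y)   ≈⟨ -‿distribˡ-* x (- y) ⟩
    - x * - y     ∎

  fromℤ : ℤ → Carrier
  fromℤ (+ n)      = n ×ₙ 1#
  fromℤ -[1+ n ]   = - (suc n ×ₙ 1#)

  fromℤ-signAbs : ∀ i → fromℤ i ≈ signed (sign i) (∣ i ∣ ×ₙ 1#)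
  fromℤ-signAbs (+ n)    = refl
  fromℤ-signAbs -[1+ n ] = refl

  fromℤ-◃ : ∀ s n → fromℤ (s ◃ n) ≈ signed s (n ×ₙ 1#)
  fromℤ-◃ Sign.+ zero    = refl
  fromℤ-◃ Sign.- zero    = sym -0#≈0#
  fromℤ-◃ Sign.+ (suc n) = refl
  fromℤ-◃ Sign.- (suc n) = refl

  fromℤ-* : ∀ i j → fromℤ (i ℤ.* j) ≈ fromℤ i * fromℤ j
  fromℤ-* i j = begin
    fromℤ (sign i Sign.* sign j ◃ ∣ i ∣ ℕ.* ∣ j ∣)
      ≈⟨ fromℤ-◃ (sign i Sign.* sign j) (∣ i ∣ ℕ.* ∣ j ∣) ⟩
    signed (sign i Sign.* sign j) ((∣ i ∣ ℕ.* ∣ j ∣) ×ₙ 1#)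
      ≈⟨ signed-cong (sign i Sign.* sign j) (×1-homo-* ∣ i ∣ ∣ j ∣) ⟩
    signed (sign i Sign.* sign j) ((∣ i ∣ ×ₙ 1#) * (∣ j ∣ ×ₙ 1#))
      ≈⟨ signed-* (sign i) (sign j) _ _ ⟩
    signed (sign i) (∣ i ∣ ×ₙ 1#) * signed (sign j) (∣ j ∣ ×ₙ 1#)
      ≈⟨ *-cong (fromℤ-signAbs i) (fromℤ-signAbs j) ⟨
    fromℤ i * fromℤ j ∎

  fromℤ-neg : ∀ i → fromℤ (ℤ.- i) ≈ - fromℤ i
  fromℤ-neg -[1+ n ]    = sym (-‿involutive _)
  fromℤ-neg (+ zero)    = sym -0#≈0#
  fromℤ-neg (+ suc n)   = refl

  1+x-[1+y]≈x-y : ∀ x y → (1# + x) - (1# + y) ≈ x - y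
  1+x-[1+y]≈x-y x y = begin
    (1# + x) - (1# + y)     ≈⟨ +-cong (+-comm 1# x) (sym (-‿+-comm 1# y)) ⟩
    (x + 1#) + (- 1# + - y) ≈⟨ +-assoc x 1# _ ⟩
    x + (1# + (- 1# + - y)) ≈⟨ +-congˡ (+-assoc 1# (- 1#) (- y)) ⟨
    x + ((1# - 1#) + - y)   ≈⟨ +-congˡ (+-congʳ (-‿inverseʳ 1#)) ⟩
    x + (0# + - y)          ≈⟨ +-congˡ (+-identityˡ (- y)) ⟩
    x - y                   ∎

  fromℤ-⊖ : ∀ m n → fromℤ (m ℤ.⊖ n) ≈ (m ×ₙ 1#) - (n ×ₙ 1#)
  fromℤ-⊖ m       zero    = sym (trans (+-congˡ -0#≈0#) (+-identityʳ _))
  fromℤ-⊖ zero    (suc n) = sym (+-identityˡ _)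
  fromℤ-⊖ (suc m) (suc n) = begin
    fromℤ (suc m ℤ.⊖ suc n)             ≡⟨ ≡.cong fromℤ (ℤ.[1+m]⊖[1+n]≡m⊖n m n) ⟩
    fromℤ (m ℤ.⊖ n)                     ≈⟨ fromℤ-⊖ m n ⟩
    (m ×ₙ 1#) - (n ×ₙ 1#)               ≈⟨ 1+x-[1+y]≈x-y _ _ ⟨
    (1# + m ×ₙ 1#) - (1# + n ×ₙ 1#)     ≈⟨ +-cong (1+× m 1#) (-‿cong (1+× n 1#)) ⟨
    (suc m ×ₙ 1#) - (suc n ×ₙ 1#)       ∎

  fromℤ-+ : ∀ i j → fromℤ (i ℤ.+ j) ≈ fromℤ i + fromℤ j
  fromℤ-+ -[1+ m ] -[1+ n ] = begin
    - (suc (suc (m ℕ.+ n)) ×ₙ 1#)       ≡⟨ ≡.cong (λ k → - (suc k ×ₙ 1#)) (ℕ.+-suc m n) ⟨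
    - ((suc m ℕ.+ suc n) ×ₙ 1#)         ≈⟨ -‿cong (×-homo-+ 1# (suc m) (suc n)) ⟩
    - ((suc m ×ₙ 1#) + (suc n ×ₙ 1#))   ≈⟨ -‿+-comm _ _ ⟨
    fromℤ -[1+ m ] + fromℤ -[1+ n ]     ∎
  fromℤ-+ -[1+ m ] (+ n) = trans (fromℤ-⊖ n (suc m)) (+-comm _ _)
  fromℤ-+ (+ m) -[1+ n ] = fromℤ-⊖ m (suc n)
  fromℤ-+ (+ m) (+ n)    = ×-homo-+ 1# m n

  fromℤ-homomorphism : ℤ.+-*-rawRing -Raw-AlmostCommutative⟶ fromCommutativeRing R
  fromℤ-homomorphism = record
    { ⟦_⟧    = fromℤ
    ; +-homo = fromℤ-+
    ; *-homo = fromℤ-*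
    ; -‿homo = fromℤ-neg
    ; 0-homo = refl
    ; 1-homo = refl
    }

  ℤ-weaklyDecidable : ∀ i j → Maybe (fromℤ i ≈ fromℤ j)
  ℤ-weaklyDecidable i j with i ℤ.≟ j
  ... | yes ≡.refl = just refl
  ... | no _       = nothing

  open import Algebra.Solver.Ring ℤ.+-*-rawRing (fromCommutativeRing R)
    fromℤ-homomorphism ℤ-weaklyDecidable public

module FieldProperties {c ℓ : Level} (F : Field c ℓ) where
  open Field F
  open import Relation.Binary.Reasoning.Setoid (Field.setoid F)

  1≉0 : ¬ 1# ≈ 0#
  1≉0 1≈0 = 0≉1 (sym 1≈0)

  x≈a*y⇒y≈b*x : ∀ {a b x y} → a * b ≈ 1# → x ≈ a * y → y ≈ b * x
  x≈a*y⇒y≈b*x {a} {b} {x} {y} ab≈1 x≈ay = begin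
    y             ≈⟨ *-identityˡ y ⟨
    1# * y        ≈⟨ *-congʳ (trans (*-comm b a) ab≈1) ⟨
    (b * a) * y   ≈⟨ *-assoc b a y ⟩
    b * (a * y)   ≈⟨ *-congˡ x≈ay ⟨
    b * x         ∎

  x*b≈y*z⇒x≈y*b⁻¹*z : ∀ {b b⁻¹ x y z} → b * b⁻¹ ≈ 1# → x * b ≈ y * z → x ≈ y * b⁻¹ * z
  x*b≈y*z⇒x≈y*b⁻¹*z {b} {b⁻¹} {x} {y} {z} bb⁻¹≈1 xb≈yz = begin
    x               ≈⟨ x≈a*y⇒y≈b*x bb⁻¹≈1 (sym (trans (*-comm b x) xb≈yz)) ⟩
    b⁻¹ * (y * z)   ≈⟨ *-assoc b⁻¹ y z ⟨
    b⁻¹ * y * z     ≈⟨ *-congʳ (*-comm b⁻¹ y) ⟩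
    y * b⁻¹ * z     ∎

  x*y≈0⇒y≈0 : ∀ {x y} → ¬ x ≈ 0# → x * y ≈ 0# → y ≈ 0#
  x*y≈0⇒y≈0 {x} {y} x≉0 xy≈0 with inverse x x≉0
  ... | x⁻¹ , xx⁻¹≈1 = begin
    y               ≈⟨ x≈a*y⇒y≈b*x xx⁻¹≈1 refl ⟩
    x⁻¹ * (x * y)   ≈⟨ *-congˡ xy≈0 ⟩
    x⁻¹ * 0#        ≈⟨ zeroʳ x⁻¹ ⟩
    0#              ∎

  x≉0∧y≉0⇒x*y≉0 : ∀ {x y} → ¬ x ≈ 0# → ¬ y ≈ 0# → ¬ x * y ≈ 0#
  x≉0∧y≉0⇒x*y≉0 x≉0 y≉0 xy≈0 = y≉0 (x*y≈0⇒y≈0 x≉0 xy≈0)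

  x*y≈1⇒y≉0 : ∀ {x y} → x * y ≈ 1# → ¬ y ≈ 0#
  x*y≈1⇒y≉0 {x} xy≈1 y≈0 = 1≉0 (trans (sym xy≈1) (trans (*-congˡ y≈0) (zeroʳ x)))

module VectorAlgebra {c ℓ : Level} (F : Field c ℓ) where
  open Field F
  open FieldProperties F
  open PG F using (Vec3; ⟨_,_,_⟩; x₀; x₁; x₂; IsZero)
  open IntegerCoefficientSolver commRing using (solve; _:=_; _:+_; _:*_; _:-_; con)

  infix  4 _≋_ _∼ᵥ_
  infixl 6 _⊕_ _⊖_
  infix  7 _·_

  _≋_ : Vec3 → Vec3 → Set ℓ
  u ≋ v = (x₀ u ≈ x₀ v) × (x₁ u ≈ x₁ v) × (x₂ u ≈ x₂ v)

  _·_ : Carrier → Vec3 → Vec3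
  a · v = ⟨ a * x₀ v , a * x₁ v , a * x₂ v ⟩

  _⊕_ _⊖_ : Vec3 → Vec3 → Vec3
  u ⊕ v = ⟨ x₀ u + x₀ v , x₁ u + x₁ v , x₂ u + x₂ v ⟩
  u ⊖ v = ⟨ x₀ u - x₀ v , x₁ u - x₁ v , x₂ u - x₂ v ⟩

  dot : Vec3 → Vec3 → Carrier
  dot u v = x₀ u * x₀ v + x₁ u * x₁ v + x₂ u * x₂ v

  cross : Vec3 → Vec3 → Vec3
  cross u v = ⟨ x₁ u * x₂ v - x₂ u * x₁ v , x₂ u * x₀ v - x₀ u * x₂ v , x₀ u * x₁ v - x₁ u * x₀ v ⟩

  -- PG._∼_ on points unfolds to _∼ᵥ_ on their coordinates.
  _∼ᵥ_ : Vec3 → Vec3 → Set (c ⊔ ℓ)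
  u ∼ᵥ v = ∃ λ a → ¬ a ≈ 0# × u ≋ a · v

  ≋-trans : ∀ {u v w} → u ≋ v → v ≋ w → u ≋ w
  ≋-trans (e₀ , e₁ , e₂) (f₀ , f₁ , f₂) = trans e₀ f₀ , trans e₁ f₁ , trans e₂ f₂

  ≋⇒∼ᵥ : ∀ {u v} → u ≋ v → u ∼ᵥ v
  ≋⇒∼ᵥ (e₀ , e₁ , e₂) = 1# , 1≉0 ,
    trans e₀ (sym (*-identityˡ _)) , trans e₁ (sym (*-identityˡ _)) , trans e₂ (sym (*-identityˡ _))

  ∼ᵥ-refl : ∀ {v} → v ∼ᵥ v
  ∼ᵥ-refl = ≋⇒∼ᵥ (refl , refl , refl)

  ∼ᵥ-sym : ∀ {u v} → u ∼ᵥ v → v ∼ᵥ u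
  ∼ᵥ-sym (a , a≉0 , e₀ , e₁ , e₂) with inverse a a≉0
  ... | b , ab≈1 = b , x*y≈1⇒y≉0 ab≈1 ,
    x≈a*y⇒y≈b*x ab≈1 e₀ , x≈a*y⇒y≈b*x ab≈1 e₁ , x≈a*y⇒y≈b*x ab≈1 e₂

  ∼ᵥ-trans : ∀ {u v w} → u ∼ᵥ v → v ∼ᵥ w → u ∼ᵥ w
  ∼ᵥ-trans (a , a≉0 , e₀ , e₁ , e₂) (b , b≉0 , f₀ , f₁ , f₂) =
    a * b , x≉0∧y≉0⇒x*y≉0 a≉0 b≉0 , compose e₀ f₀ , compose e₁ f₁ , compose e₂ f₂
    where
    compose : ∀ {x y z} → x ≈ a * y → y ≈ b * z → x ≈ (a * b) * z
    compose e f = trans e (trans (*-congˡ f) (sym (*-assoc a b _)))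

  dot-comm : ∀ u v → dot u v ≈ dot v u
  dot-comm u v = +-cong (+-cong (*-comm _ _) (*-comm _ _)) (*-comm _ _)

  dot-congʳ : ∀ u {v w} → v ≋ w → dot u v ≈ dot u w
  dot-congʳ u (e₀ , e₁ , e₂) = +-cong (+-cong (*-congˡ e₀) (*-congˡ e₁)) (*-congˡ e₂)

  dot-·ʳ : ∀ u a v → dot u (a · v) ≈ a * dot u v
  dot-·ʳ u a v = solve 7 (λ a u₀ u₁ u₂ v₀ v₁ v₂ →
      u₀ :* (a :* v₀) :+ u₁ :* (a :* v₁) :+ u₂ :* (a :* v₂) := a :* (u₀ :* v₀ :+ u₁ :* v₁ :+ u₂ :* v₂))
    refl a (x₀ u) (x₁ u) (x₂ u) (x₀ v) (x₁ v) (x₂ v)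

  dot-⊕ʳ : ∀ u v w → dot u (v ⊕ w) ≈ dot u v + dot u w
  dot-⊕ʳ u v w = solve 9 (λ u₀ u₁ u₂ v₀ v₁ v₂ w₀ w₁ w₂ →
      u₀ :* (v₀ :+ w₀) :+ u₁ :* (v₁ :+ w₁) :+ u₂ :* (v₂ :+ w₂)
    := (u₀ :* v₀ :+ u₁ :* v₁ :+ u₂ :* v₂) :+ (u₀ :* w₀ :+ u₁ :* w₁ :+ u₂ :* w₂))
    refl (x₀ u) (x₁ u) (x₂ u) (x₀ v) (x₁ v) (x₂ v) (x₀ w) (x₁ w) (x₂ w)

  cross-orthogonalˡ : ∀ u v → dot (cross u v) u ≈ 0#
  cross-orthogonalˡ u v = solve 6 (λ u₀ u₁ u₂ v₀ v₁ v₂ →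
      (u₁ :* v₂ :- u₂ :* v₁) :* u₀ :+ (u₂ :* v₀ :- u₀ :* v₂) :* u₁ :+ (u₀ :* v₁ :- u₁ :* v₀) :* u₂
    := con (+ 0)) refl (x₀ u) (x₁ u) (x₂ u) (x₀ v) (x₁ v) (x₂ v)

  cross-orthogonalʳ : ∀ u v → dot (cross u v) v ≈ 0#
  cross-orthogonalʳ u v = solve 6 (λ u₀ u₁ u₂ v₀ v₁ v₂ →
      (u₁ :* v₂ :- u₂ :* v₁) :* v₀ :+ (u₂ :* v₀ :- u₀ :* v₂) :* v₁ :+ (u₀ :* v₁ :- u₁ :* v₀) :* v₂
    := con (+ 0)) refl (x₀ u) (x₁ u) (x₂ u) (x₀ v) (x₁ v) (x₂ v)

  cross-cross : ∀ u v w → cross (cross u v) w ≋ dot u w · v ⊖ dot v w · u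
  cross-cross u v w =
      solve 9 (λ u₀ u₁ u₂ v₀ v₁ v₂ w₀ w₁ w₂ →
          (u₂ :* v₀ :- u₀ :* v₂) :* w₂ :- (u₀ :* v₁ :- u₁ :* v₀) :* w₁
        := (u₀ :* w₀ :+ u₁ :* w₁ :+ u₂ :* w₂) :* v₀ :- (v₀ :* w₀ :+ v₁ :* w₁ :+ v₂ :* w₂) :* u₀)
        refl u₀ u₁ u₂ v₀ v₁ v₂ w₀ w₁ w₂
    , solve 9 (λ u₀ u₁ u₂ v₀ v₁ v₂ w₀ w₁ w₂ →
          (u₀ :* v₁ :- u₁ :* v₀) :* w₀ :- (u₁ :* v₂ :- u₂ :* v₁) :* w₂
        := (u₀ :* w₀ :+ u₁ :* w₁ :+ u₂ :* w₂) :* v₁ :- (v₀ :* w₀ :+ v₁ :* w₁ :+ v₂ :* w₂) :* u₁)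
        refl u₀ u₁ u₂ v₀ v₁ v₂ w₀ w₁ w₂
    , solve 9 (λ u₀ u₁ u₂ v₀ v₁ v₂ w₀ w₁ w₂ →
          (u₁ :* v₂ :- u₂ :* v₁) :* w₁ :- (u₂ :* v₀ :- u₀ :* v₂) :* w₀
        := (u₀ :* w₀ :+ u₁ :* w₁ :+ u₂ :* w₂) :* v₂ :- (v₀ :* w₀ :+ v₁ :* w₁ :+ v₂ :* w₂) :* u₂)
        refl u₀ u₁ u₂ v₀ v₁ v₂ w₀ w₁ w₂
    where
    open PG.Vec3 u renaming (x₀ to u₀; x₁ to u₁; x₂ to u₂)
    open PG.Vec3 v renaming (x₀ to v₀; x₁ to v₁; x₂ to v₂)
    open PG.Vec3 w renaming (x₀ to w₀; x₁ to w₁; x₂ to w₂)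

  cross-⊖ˡ : ∀ u a v w → cross (u ⊖ a · v) w ≋ cross u w ⊖ a · cross v w
  cross-⊖ˡ u a v w =
    coordinate (x₁ u) (x₁ v) (x₂ w) (x₂ u) (x₂ v) (x₁ w) ,
    coordinate (x₂ u) (x₂ v) (x₀ w) (x₀ u) (x₀ v) (x₂ w) ,
    coordinate (x₀ u) (x₀ v) (x₁ w) (x₁ u) (x₁ v) (x₀ w)
    where
    coordinate : ∀ p q r s t m → (p - a * q) * r - (s - a * t) * m ≈ (p * r - s * m) - a * (q * r - t * m)
    coordinate = solve 7 (λ a p q r s t m →
      (p :- a :* q) :* r :- (s :- a :* t) :* m := (p :* r :- s :* m) :- a :* (q :* r :- t :* m)) refl a

  ·⊖·-zero : ∀ {a b} u v → a ≈ 0# → b ≈ 0# → IsZero (a · u ⊖ b · v)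
  ·⊖·-zero {a} {b} u v a≈0 b≈0 = coordinate (x₀ u) (x₀ v) , coordinate (x₁ u) (x₁ v) , coordinate (x₂ u) (x₂ v)
    where
    coordinate : ∀ x y → a * x - b * y ≈ 0#
    coordinate x y = trans (+-cong (trans (*-congʳ a≈0) (zeroˡ x)) (-‿cong (trans (*-congʳ b≈0) (zeroˡ y))))
                           (-‿inverseʳ 0#)

module Geometry {c ℓ : Level} (F : Field c ℓ) (_≟_ : Decidable (Field._≈_ F)) where
  open Field F
  open FieldProperties F
  open VectorAlgebra F
  open PG F
  open import Algebra.Properties.Ring ring using (x∙y⁻¹≈ε⇒x≈y; x≈y⇒x∙y⁻¹≈ε; +-inverseˡ-unique)
  open IntegerCoefficientSolver commRing using (solve; _:=_; _:+_; _:*_; _:-_; :-_; con)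

  nonzero-coordinate : ∀ v → ¬ IsZero v → ¬ x₀ v ≈ 0# ⊎ ¬ x₁ v ≈ 0# ⊎ ¬ x₂ v ≈ 0#
  nonzero-coordinate v v≉0 with x₀ v ≟ 0# | x₁ v ≟ 0# | x₂ v ≟ 0#
  ... | no x₀≉0  | _        | _        = inj₁ x₀≉0
  ... | yes _    | no x₁≉0  | _        = inj₂ (inj₁ x₁≉0)
  ... | yes _    | yes _    | no x₂≉0  = inj₂ (inj₂ x₂≉0)
  ... | yes x₀≈0 | yes x₁≈0 | yes x₂≈0 = ⊥-elim (v≉0 (x₀≈0 , x₁≈0 , x₂≈0))

  ·-zero⇒zero : ∀ {a} v → ¬ IsZero v → IsZero (a · v) → a ≈ 0#
  ·-zero⇒zero {a} v v≉0 (z₀ , z₁ , z₂) with nonzero-coordinate v v≉0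
  ... | inj₁ x₀≉0        = x*y≈0⇒y≈0 x₀≉0 (trans (*-comm _ a) z₀)
  ... | inj₂ (inj₁ x₁≉0) = x*y≈0⇒y≈0 x₁≉0 (trans (*-comm _ a) z₁)
  ... | inj₂ (inj₂ x₂≉0) = x*y≈0⇒y≈0 x₂≉0 (trans (*-comm _ a) z₂)

  collinear⇒∼ᵥ : ∀ {u v d} → ¬ IsZero u → u ≋ d · v → u ∼ᵥ v
  collinear⇒∼ᵥ {d = d} u≉0 u≋dv@(e₀ , e₁ , e₂) with d ≟ 0#
  ... | no d≉0 = d , d≉0 , u≋dv
  ... | yes d≈0 = ⊥-elim (u≉0 (vanish e₀ , vanish e₁ , vanish e₂))
    where
    vanish : ∀ {x y} → x ≈ d * y → x ≈ 0#
    vanish {y = y} e = trans e (trans (*-congʳ d≈0) (zeroˡ y))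

  cross-zero⇒collinear : ∀ u v → ¬ IsZero v → IsZero (cross u v) → ∃ λ d → u ≋ d · v
  cross-zero⇒collinear u v v≉0 (c₀ , c₁ , c₂) = by-coordinate (nonzero-coordinate v v≉0)
    where
    open PG.Vec3 u renaming (x₀ to u₀; x₁ to u₁; x₂ to u₂)
    open PG.Vec3 v renaming (x₀ to v₀; x₁ to v₁; x₂ to v₂)
    e₁₂ : u₁ * v₂ ≈ u₂ * v₁
    e₁₂ = x∙y⁻¹≈ε⇒x≈y _ _ c₀
    e₂₀ : u₂ * v₀ ≈ u₀ * v₂
    e₂₀ = x∙y⁻¹≈ε⇒x≈y _ _ c₁
    e₀₁ : u₀ * v₁ ≈ u₁ * v₀
    e₀₁ = x∙y⁻¹≈ε⇒x≈y _ _ c₂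
    by-coordinate : ¬ v₀ ≈ 0# ⊎ ¬ v₁ ≈ 0# ⊎ ¬ v₂ ≈ 0# → ∃ λ d → u ≋ d · v
    by-coordinate (inj₁ v₀≉0) with inverse v₀ v₀≉0
    ... | w , v₀w≈1 = u₀ * w ,
      x*b≈y*z⇒x≈y*b⁻¹*z v₀w≈1 refl , x*b≈y*z⇒x≈y*b⁻¹*z v₀w≈1 (sym e₀₁) , x*b≈y*z⇒x≈y*b⁻¹*z v₀w≈1 e₂₀
    by-coordinate (inj₂ (inj₁ v₁≉0)) with inverse v₁ v₁≉0
    ... | w , v₁w≈1 = u₁ * w ,
      x*b≈y*z⇒x≈y*b⁻¹*z v₁w≈1 e₀₁ , x*b≈y*z⇒x≈y*b⁻¹*z v₁w≈1 refl , x*b≈y*z⇒x≈y*b⁻¹*z v₁w≈1 (sym e₁₂)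
    by-coordinate (inj₂ (inj₂ v₂≉0)) with inverse v₂ v₂≉0
    ... | w , v₂w≈1 = u₂ * w ,
      x*b≈y*z⇒x≈y*b⁻¹*z v₂w≈1 (sym e₂₀) , x*b≈y*z⇒x≈y*b⁻¹*z v₂w≈1 e₁₂ , x*b≈y*z⇒x≈y*b⁻¹*z v₂w≈1 refl

  cross-nonzero : ∀ {u v} → ¬ IsZero u → ¬ IsZero v → ¬ u ∼ᵥ v → ¬ IsZero (cross u v)
  cross-nonzero {u} {v} u≉0 v≉0 u≁v uv≈0 = u≁v (collinear⇒∼ᵥ u≉0 (proj₂ (cross-zero⇒collinear u v v≉0 uv≈0)))

  orthogonal⇒∼ᵥcross : ∀ {l p q} → ¬ IsZero l → ¬ IsZero p → ¬ IsZero q → ¬ p ∼ᵥ q →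
                       dot l p ≈ 0# → dot l q ≈ 0# → l ∼ᵥ cross p q
  orthogonal⇒∼ᵥcross {l} {p} {q} l≉0 p≉0 q≉0 p≁q lp≈0 lq≈0 =
    ∼ᵥ-sym (collinear⇒∼ᵥ (cross-nonzero p≉0 q≉0 p≁q) (proj₂ (cross-zero⇒collinear (cross p q) l l≉0 pql≈0)))
    where
    pql≈0 : IsZero (cross (cross p q) l)
    pql≈0 = ≋-trans (cross-cross p q l)
              (·⊖·-zero q p (trans (dot-comm p l) lp≈0) (trans (dot-comm q l) lq≈0))

  ≋⇒⊖-zero : ∀ {u v} → u ≋ v → IsZero (u ⊖ v)
  ≋⇒⊖-zero (e₀ , e₁ , e₂) = x≈y⇒x∙y⁻¹≈ε e₀ , x≈y⇒x∙y⁻¹≈ε e₁ , x≈y⇒x∙y⁻¹≈ε e₂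

  independent : ∀ {u v a b} → ¬ IsZero u → ¬ IsZero v → ¬ u ∼ᵥ v → IsZero (a · u ⊕ b · v) → a ≈ 0# × b ≈ 0#
  independent {u} {v} {a} {b} u≉0 v≉0 u≁v (z₀ , z₁ , z₂) = by-cases (a ≟ 0#)
    where
    by-cases : Dec (a ≈ 0#) → a ≈ 0# × b ≈ 0#
    by-cases (yes a≈0) = a≈0 , ·-zero⇒zero v v≉0 (drop z₀ , drop z₁ , drop z₂)
      where
      drop : ∀ {x y} → a * x + b * y ≈ 0# → b * y ≈ 0#
      drop {x} {y} e = trans (sym (+-identityˡ _)) (trans (+-congʳ (sym (trans (*-congʳ a≈0) (zeroˡ x)))) e)
    by-cases (no a≉0) with inverse a a≉0
    ... | a⁻¹ , aa⁻¹≈1 = ⊥-elim (u≁v (collinear⇒∼ᵥ u≉0 (isolate z₀ , isolate z₁ , isolate z₂)))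
      where
      isolate : ∀ {x y} → a * x + b * y ≈ 0# → x ≈ - (a⁻¹ * b) * y
      isolate {x} {y} e = trans (x≈a*y⇒y≈b*x aa⁻¹≈1 refl)
        (trans (*-congˡ (+-inverseˡ-unique _ _ e))
          (solve 3 (λ a⁻¹ b y → a⁻¹ :* (:- (b :* y)) := :- (a⁻¹ :* b) :* y) refl a⁻¹ b y))

  offset-not-collinear : ∀ {u v t a} → ¬ IsZero u → ¬ IsZero v → ¬ u ∼ᵥ v → ¬ u ⊕ t · v ≋ a · v
  offset-not-collinear {u} {v} {t} {a} u≉0 v≉0 u≁v (e₀ , e₁ , e₂) =
    1≉0 (proj₁ (independent u≉0 v≉0 u≁v (rearrange e₀ , rearrange e₁ , rearrange e₂)))
    where
    rearrange : ∀ {x y} → x + t * y ≈ a * y → 1# * x + (t - a) * y ≈ 0#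
    rearrange {x} {y} e = trans (solve 4 (λ x y t a → con (+ 1) :* x :+ (t :- a) :* y := (x :+ t :* y) :- a :* y)
                                   refl x y t a) (x≈y⇒x∙y⁻¹≈ε e)

  offset-injective : ∀ {u v s t a} → ¬ IsZero u → ¬ IsZero v → ¬ u ∼ᵥ v →
                     u ⊕ s · v ≋ a · (u ⊕ t · v) → s ≈ t
  offset-injective {u} {v} {s} {t} {a} u≉0 v≉0 u≁v (e₀ , e₁ , e₂) =
    conclude (independent u≉0 v≉0 u≁v (rearrange e₀ , rearrange e₁ , rearrange e₂))
    where
    open import Relation.Binary.Reasoning.Setoid (Field.setoid F)
    rearrange : ∀ {x y} → x + s * y ≈ a * (x + t * y) → (1# - a) * x + (s - a * t) * y ≈ 0#
    rearrange {x} {y} e = trans (solve 5 (λ x y s t a →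
        (con (+ 1) :- a) :* x :+ (s :- a :* t) :* y := (x :+ s :* y) :- a :* (x :+ t :* y)) refl x y s t a)
      (x≈y⇒x∙y⁻¹≈ε e)
    conclude : 1# - a ≈ 0# × s - a * t ≈ 0# → s ≈ t
    conclude (1-a≈0 , s-at≈0) = begin
      s        ≈⟨ x∙y⁻¹≈ε⇒x≈y s (a * t) s-at≈0 ⟩
      a * t    ≈⟨ *-congʳ (x∙y⁻¹≈ε⇒x≈y 1# a 1-a≈0) ⟨
      1# * t   ≈⟨ *-identityˡ t ⟩
      t        ∎

  collinear-decomposition : ∀ {l p q x} → ¬ IsZero l → ¬ IsZero p → ¬ IsZero q → ¬ IsZero x →
    ¬ q ∼ᵥ p → ¬ x ∼ᵥ p → dot l p ≈ 0# → dot l q ≈ 0# → dot l x ≈ 0# → ∃ λ t → x ∼ᵥ q ⊕ t · p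
  collinear-decomposition {l} {p} {q} {x} l≉0 p≉0 q≉0 x≉0 q≁p x≁p lp≈0 lq≈0 lx≈0 =
    decompose (∼ᵥ-trans (∼ᵥ-sym (orthogonal⇒∼ᵥcross l≉0 x≉0 p≉0 x≁p lx≈0 lp≈0))
                        (orthogonal⇒∼ᵥcross l≉0 q≉0 p≉0 q≁p lq≈0 lp≈0))
    where
    decompose : cross x p ∼ᵥ cross q p → ∃ λ t → x ∼ᵥ q ⊕ t · p
    decompose (c , c≉0 , xp≋c·qp) = rescale (inverse c c≉0)
      (cross-zero⇒collinear (x ⊖ c · q) p p≉0 (≋-trans (cross-⊖ˡ x c q p) (≋⇒⊖-zero xp≋c·qp)))
      where
      rescale : (∃ λ c⁻¹ → c * c⁻¹ ≈ 1#) → (∃ λ d → x ⊖ c · q ≋ d · p) → ∃ λ t → x ∼ᵥ q ⊕ t · p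
      rescale (c⁻¹ , cc⁻¹≈1) (d , e₀ , e₁ , e₂) =
        c⁻¹ * d , c , c≉0 , recombine e₀ , recombine e₁ , recombine e₂
        where
        recombine : ∀ {xᵢ qᵢ pᵢ} → xᵢ - c * qᵢ ≈ d * pᵢ → xᵢ ≈ c * (qᵢ + c⁻¹ * d * pᵢ)
        recombine {xᵢ} {qᵢ} {pᵢ} e = begin
          xᵢ                               ≈⟨ solve 3 (λ x c q → x := (x :- c :* q) :+ c :* q) refl xᵢ c qᵢ ⟩
          (xᵢ - c * qᵢ) + c * qᵢ           ≈⟨ +-congʳ (trans e (sym (*-identityˡ _))) ⟩
          1# * (d * pᵢ) + c * qᵢ           ≈⟨ +-congʳ (*-congʳ cc⁻¹≈1) ⟨
          (c * c⁻¹) * (d * pᵢ) + c * qᵢ    ≈⟨ solve 5 (λ c c⁻¹ d p q → (c :* c⁻¹) :* (d :* p) :+ c :* q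
                                                      := c :* (q :+ c⁻¹ :* d :* p)) refl c c⁻¹ d pᵢ qᵢ ⟩
          c * (qᵢ + c⁻¹ * d * pᵢ)          ∎
          where open import Relation.Binary.Reasoning.Setoid (Field.setoid F)

  I-sym : ∀ P L → P I L → L I P
  I-sym P L P∈L = trans (dot-comm (coords P) (coords L)) P∈L

  I-respˡ : ∀ P Q L → P ∼ Q → P I L → Q I L
  I-respˡ P Q L P∼Q P∈L with ∼ᵥ-sym P∼Q
  ... | a , _ , Q≋aP = trans (dot-congʳ (coords L) Q≋aP)
                             (trans (dot-·ʳ (coords L) a (coords P)) (trans (*-congˡ P∈L) (zeroʳ a)))

  I-respʳ : ∀ P L M → L ∼ M → P I L → P I M
  I-respʳ P L M L∼M P∈L = I-sym M P (I-respˡ L M P L∼M (I-sym P L P∈L))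

  join : (P Q : Point) → ¬ P ∼ Q → Line
  join P Q P≁Q = cross (coords P) (coords Q) , cross-nonzero (proj₂ P) (proj₂ Q) P≁Q

  join-Iˡ : ∀ P Q P≁Q → P I join P Q P≁Q
  join-Iˡ P Q _ = cross-orthogonalˡ (coords P) (coords Q)

  join-Iʳ : ∀ P Q P≁Q → Q I join P Q P≁Q
  join-Iʳ P Q _ = cross-orthogonalʳ (coords P) (coords Q)

  join-unique : ∀ P Q L (P≁Q : ¬ P ∼ Q) → P I L → Q I L → L ∼ join P Q P≁Q
  join-unique P Q L P≁Q = orthogonal⇒∼ᵥcross (proj₂ L) (proj₂ P) (proj₂ Q) P≁Q

  line-unique : ∀ P Q L M → ¬ P ∼ Q → P I L → Q I L → P I M → Q I M → L ∼ M
  line-unique P Q L M P≁Q P∈L Q∈L P∈M Q∈M =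
    ∼ᵥ-trans (join-unique P Q L P≁Q P∈L Q∈L) (∼ᵥ-sym (join-unique P Q M P≁Q P∈M Q∈M))

  -- Points and lines are both nonzero vectors and incidence is symmetric (I-sym),
  -- so two lines meet in their join in the dual plane.
  meet : (L M : Line) → ¬ L ∼ M → Point
  meet = join

  meet-unique : ∀ P L M (L≁M : ¬ L ∼ M) → P I L → P I M → P ∼ meet L M L≁M
  meet-unique P L M L≁M P∈L P∈M = join-unique L M P L≁M (I-sym P L P∈L) (I-sym P M P∈M)

  non-concurrent : ∀ L₁ L₂ L₃ (L₁≁L₃ : ¬ L₁ ∼ L₃) → ¬ meet L₁ L₃ L₁≁L₃ I L₂ →
                   ¬ (∃ λ P → P I L₁ × P I L₂ × P I L₃)
  non-concurrent L₁ L₂ L₃ L₁≁L₃ R∉L₂ (P , P∈L₁ , P∈L₂ , P∈L₃) =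
    R∉L₂ (I-respˡ P (meet L₁ L₃ L₁≁L₃) L₂ (meet-unique P L₁ L₃ L₁≁L₃ P∈L₁ P∈L₃) P∈L₂)

  e₀ e₁ e₂ : Point
  e₀ = ⟨ 1# , 0# , 0# ⟩ , λ (1≈0 , _ , _) → 1≉0 1≈0
  e₁ = ⟨ 0# , 1# , 0# ⟩ , λ (_ , 1≈0 , _) → 1≉0 1≈0
  e₂ = ⟨ 0# , 0# , 1# ⟩ , λ (_ , _ , 1≈0) → 1≉0 1≈0

  line-avoiding : ∀ P → ∃ λ L → ¬ P I L
  line-avoiding P = avoid (nonzero-coordinate (coords P) (proj₂ P))
    where
    open PG.Vec3 (coords P) renaming (x₀ to p₀; x₁ to p₁; x₂ to p₂)
    avoid : ¬ p₀ ≈ 0# ⊎ ¬ p₁ ≈ 0# ⊎ ¬ p₂ ≈ 0# → ∃ λ L → ¬ P I L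
    avoid (inj₁ p₀≉0) = e₀ , λ P∈e₀ → p₀≉0 (trans (solve 3 (λ p₀ p₁ p₂ →
      p₀ := con (+ 1) :* p₀ :+ con (+ 0) :* p₁ :+ con (+ 0) :* p₂) refl p₀ p₁ p₂) P∈e₀)
    avoid (inj₂ (inj₁ p₁≉0)) = e₁ , λ P∈e₁ → p₁≉0 (trans (solve 3 (λ p₀ p₁ p₂ →
      p₁ := con (+ 0) :* p₀ :+ con (+ 1) :* p₁ :+ con (+ 0) :* p₂) refl p₀ p₁ p₂) P∈e₁)
    avoid (inj₂ (inj₂ p₂≉0)) = e₂ , λ P∈e₂ → p₂≉0 (trans (solve 3 (λ p₀ p₁ p₂ →
      p₂ := con (+ 0) :* p₀ :+ con (+ 0) :* p₁ :+ con (+ 1) :* p₂) refl p₀ p₁ p₂) P∈e₂)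

  point-on : ∀ L → ∃ λ P → P I L
  point-on L = on (x₀ (coords L) ≟ 0#)
    where
    on-meet : ∀ E → ¬ L ∼ E → ∃ λ P → P I L
    on-meet E L≁E = meet L E L≁E , I-sym L (meet L E L≁E) (join-Iˡ L E L≁E)
    on : Dec (x₀ (coords L) ≈ 0#) → ∃ λ P → P I L
    on (yes l₀≈0) = on-meet e₀ λ (a , a≉0 , l₀≈a1 , _) → a≉0 (trans (sym (*-identityʳ a)) (trans (sym l₀≈a1) l₀≈0))
    on (no l₀≉0)  = on-meet e₁ λ (a , _ , l₀≈a0 , _) → l₀≉0 (trans l₀≈a0 (zeroʳ a))

  other-point-on : ∀ P L → P I L → ∃ λ Q → Q I L × ¬ Q ∼ P
  other-point-on P L P∈L with line-avoiding P
  ... | E , P∉E = Q , I-sym L Q (join-Iˡ L E L≁E) , λ Q∼P → P∉E (I-respˡ Q P E Q∼P (I-sym E Q (join-Iʳ L E L≁E)))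
    where
    L≁E : ¬ L ∼ E
    L≁E L∼E = P∉E (I-respʳ P L E L∼E P∈L)
    Q : Point
    Q = meet L E L≁E

  module _ (B C : Point) (B≁C : ¬ B ∼ C) where

    -- B + t C; with C these are all the points of the line BC (pointAt-surjective).
    pointAt : Carrier → Point
    pointAt t = coords B ⊕ t · coords C , λ (z₀ , z₁ , z₂) →
      offset-not-collinear (proj₂ B) (proj₂ C) B≁C (vanish z₀ , vanish z₁ , vanish z₂)
      where
      vanish : ∀ {x y} → x ≈ 0# → x ≈ 0# * y
      vanish {y = y} x≈0 = trans x≈0 (sym (zeroˡ y))

    pointAt-I : ∀ t L → B I L → C I L → pointAt t I L
    pointAt-I t L B∈L C∈L = trans (dot-⊕ʳ (coords L) (coords B) (t · coords C))
      (trans (+-cong B∈L (trans (dot-·ʳ (coords L) t (coords C)) (trans (*-congˡ C∈L) (zeroʳ t))))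
             (+-identityʳ 0#))

    pointAt≁C : ∀ t → ¬ pointAt t ∼ C
    pointAt≁C t (a , _ , e) = offset-not-collinear (proj₂ B) (proj₂ C) B≁C e

    pointAt-cong : ∀ {s t} → s ≈ t → pointAt s ∼ pointAt t
    pointAt-cong s≈t = ≋⇒∼ᵥ (+-congˡ (*-congʳ s≈t) , +-congˡ (*-congʳ s≈t) , +-congˡ (*-congʳ s≈t))

    pointAt-injective : ∀ s t → pointAt s ∼ pointAt t → s ≈ t
    pointAt-injective s t (a , _ , e) = offset-injective (proj₂ B) (proj₂ C) B≁C e

  pointAt-surjective : ∀ P Q L (Q≁P : ¬ Q ∼ P) → P I L → Q I L →
                       ∀ X → X I L → ¬ X ∼ P → ∃ λ t → X ∼ pointAt Q P Q≁P t
  pointAt-surjective P Q L Q≁P P∈L Q∈L X X∈L X≁P =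
    collinear-decomposition (proj₂ L) (proj₂ P) (proj₂ Q) (proj₂ X) Q≁P X≁P P∈L Q∈L X∈L

module FinitePlane {c ℓ : Level} (F : Field c ℓ) {q : ℕ} (F↔Fin : Inverse (Field.setoid F) (setoid (Fin q))) where
  open Field F
  open VectorAlgebra F
  open PG F
  open Inverse F↔Fin using (to; from; to-cong; strictlyInverseˡ; strictlyInverseʳ)

  from-injective : ∀ {i j} → from i ≈ from j → i ≡ j
  from-injective {i} {j} e = ≡.trans (≡.sym (strictlyInverseˡ i)) (≡.trans (to-cong e) (strictlyInverseˡ j))

  to-injective : ∀ {x y} → to x ≡ to y → x ≈ y
  to-injective {x} {y} e = trans (sym (strictlyInverseʳ x)) (trans (reflexive (≡.cong from e)) (strictlyInverseʳ y))

  _≟_ : Decidable _≈_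
  x ≟ y = map′ to-injective to-cong (to x Fin.≟ to y)

  open Geometry F _≟_ public

  IsZero? : ∀ v → Dec (IsZero v)
  IsZero? v = (x₀ v ≟ 0#) ×-dec (x₁ v ≟ 0#) ×-dec (x₂ v ≟ 0#)

  Invariant : ∀ {r} → (Point → Set r) → Set (c ⊔ ℓ ⊔ r)
  Invariant R = ∀ P Q → P ∼ Q → R P → R Q

  any-point? : ∀ {r} (R : Point → Set r) → Invariant R → (∀ P → Dec (R P)) → Dec (∃ R)
  any-point? R R-inv R? = map′ found complete
    (Fin.any? λ i → Fin.any? λ j → Fin.any? λ k → at ⟨ from i , from j , from k ⟩)
    where
    at : ∀ v → Dec (∃ λ (v≉0 : ¬ IsZero v) → R (v , v≉0))
    at v with IsZero? v
    ... | yes v≈0 = no λ (v≉0 , _) → v≉0 v≈0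
    ... | no v≉0  = map′ (v≉0 ,_) (λ (_ , r) → R-inv _ _ ∼ᵥ-refl r) (R? (v , v≉0))
    found : (∃ λ i → ∃ λ j → ∃ λ k → ∃ λ v≉0 → R (⟨ from i , from j , from k ⟩ , v≉0)) → ∃ R
    found (_ , _ , _ , _ , r) = _ , r
    complete : ∃ R → ∃ λ i → ∃ λ j → ∃ λ k → ∃ λ v≉0 → R (⟨ from i , from j , from k ⟩ , v≉0)
    complete (P , r) = to p₀ , to p₁ , to p₂ , (λ z → proj₂ P (≋-trans P≋ z)) , R-inv P _ (≋⇒∼ᵥ P≋) r
      where
      open PG.Vec3 (coords P) renaming (x₀ to p₀; x₁ to p₁; x₂ to p₂)
      P≋ : coords P ≋ ⟨ from (to p₀) , from (to p₁) , from (to p₂) ⟩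
      P≋ = sym (strictlyInverseʳ p₀) , sym (strictlyInverseʳ p₁) , sym (strictlyInverseʳ p₂)

  all-points? : ∀ {r} (R : Point → Set r) → Invariant R → (∀ P → Dec (R P)) → Dec (∀ P → R P)
  all-points? R R-inv R? = map′
    (λ no-counterexample P → decidable-stable (R? P) (λ ¬r → no-counterexample (P , ¬r)))
    (λ all (P , ¬r) → ¬r (all P))
    (¬? (any-point? (λ P → ¬ R P) (λ P Q P∼Q ¬rP rQ → ¬rP (R-inv Q P (∼ᵥ-sym P∼Q) rQ)) (λ P → ¬? (R? P))))

  I? : ∀ P L → Dec (P I L)
  I? P L = _ ≟ 0#

  infix 4 _≋?_ _∼?_

  _≋?_ : ∀ u v → Dec (u ≋ v)
  u ≋? v = (x₀ u ≟ x₀ v) ×-dec (x₁ u ≟ x₁ v) ×-dec (x₂ u ≟ x₂ v)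

  _∼?_ : ∀ P Q → Dec (P ∼ Q)
  P ∼? Q = map′ (λ (i , found) → from i , found) complete
    (Fin.any? λ i → ¬? (from i ≟ 0#) ×-dec (coords P ≋? from i · coords Q))
    where
    complete : P ∼ Q → ∃ λ i → ¬ from i ≈ 0# × coords P ≋ from i · coords Q
    complete (a , a≉0 , e₀ , e₁ , e₂) =
      to a , (λ z → a≉0 (trans (sym a≈) z)) , rescale e₀ , rescale e₁ , rescale e₂
      where
      a≈ : from (to a) ≈ a
      a≈ = strictlyInverseʳ a
      rescale : ∀ {x y} → x ≈ a * y → x ≈ from (to a) * y
      rescale e = trans e (*-congʳ (sym a≈))

  module _ (B C : Point) (B≁C : ¬ B ∼ C) where

    line-points : Fin (suc q) → Point
    line-points Fin.zero    = C
    line-points (Fin.suc k) = pointAt B C B≁C (from k)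

    line-points-I : ∀ L → B I L → C I L → ∀ i → line-points i I L
    line-points-I L B∈L C∈L Fin.zero    = C∈L
    line-points-I L B∈L C∈L (Fin.suc k) = pointAt-I B C B≁C (from k) L B∈L C∈L

    line-points-injective : Injective _≡_ _∼_ line-points
    line-points-injective {Fin.zero}  {Fin.zero}   _ = ≡.refl
    line-points-injective {Fin.zero}  {Fin.suc k}  C∼ = ⊥-elim (pointAt≁C B C B≁C (from k) (∼ᵥ-sym C∼))
    line-points-injective {Fin.suc k} {Fin.zero}   ∼C = ⊥-elim (pointAt≁C B C B≁C (from k) ∼C)
    line-points-injective {Fin.suc k} {Fin.suc k′} e  =
      ≡.cong Fin.suc (from-injective (pointAt-injective B C B≁C (from k) (from k′) e))

  line-minus-point-notInjective : ∀ P Q L → ¬ Q ∼ P → P I L → Q I L →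
    (Z : Fin (suc q) → Point) → (∀ i → Z i I L) → (∀ i → ¬ Z i ∼ P) → ¬ Injective _≡_ _∼_ Z
  line-minus-point-notInjective P Q L Q≁P P∈L Q∈L Z Z∈L Z≁P Z-injective =
    Fin.<⇒notInjective {f = λ i → to (parameter i)} (ℕ.n<1+n q) parameter-injective
    where
    parameter : Fin (suc q) → Carrier
    parameter i = proj₁ (pointAt-surjective P Q L Q≁P P∈L Q∈L (Z i) (Z∈L i) (Z≁P i))
    Z∼pointAt : ∀ i → Z i ∼ pointAt Q P Q≁P (parameter i)
    Z∼pointAt i = proj₂ (pointAt-surjective P Q L Q≁P P∈L Q∈L (Z i) (Z∈L i) (Z≁P i))
    parameter-injective : Injective _≡_ _≡_ (λ i → to (parameter i))
    parameter-injective {i} {j} e = Z-injective (∼ᵥ-trans (Z∼pointAt i)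
      (∼ᵥ-trans (pointAt-cong Q P Q≁P (to-injective e)) (∼ᵥ-sym (Z∼pointAt j))))

module Collineations {c ℓ : Level} (F : Field c ℓ) {q : ℕ} (F↔Fin : Inverse (Field.setoid F) (setoid (Fin q)))
                     (π : PG.PointPerm F) where
  open VectorAlgebra F using (∼ᵥ-sym; ∼ᵥ-trans)
  open PG F
  open FinitePlane F F↔Fin

  f : Point → Point
  f = fun π

  ImageIsLine-invariant : Invariant (ImageIsLine π)
  ImageIsLine-invariant L L′ L∼L′ (M , maps , covers) =
    M , (λ P P∈L′ → maps P (I-respʳ P L′ L (∼ᵥ-sym L∼L′) P∈L′)) ,
    (λ Q Q∈M → let (P , P∈L , fP∼Q) = covers Q Q∈M in P , I-respʳ P L L′ L∼L′ P∈L , fP∼Q)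

  ImageIsLine? : ∀ L → Dec (ImageIsLine π L)
  ImageIsLine? L = any-point? (ImageIs π L) ImageIs-invariant λ M →
      all-points? (Maps M) (maps-invariant M) (λ P → I? P L →-dec I? (f P) M)
    ×-dec all-points? (Covered M) (covered-invariant M)
            (λ Q → I? Q M →-dec any-point? (Preimage Q) (preimage-invariant Q) (λ P → I? P L ×-dec (f P ∼? Q)))
    where
    Maps : Line → Point → Set ℓ
    Maps M P = P I L → f P I M
    Covered : Line → Point → Set (c ⊔ ℓ)
    Covered M Q = Q I M → ∃ λ P → P I L × f P ∼ Q
    Preimage : Point → Point → Set (c ⊔ ℓ)
    Preimage Q P = P I L × f P ∼ Q

    ImageIs-invariant : Invariant (ImageIs π L)
    ImageIs-invariant M M′ M∼M′ (maps , covers) =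
      (λ P P∈L → I-respʳ (f P) M M′ M∼M′ (maps P P∈L)) ,
      (λ Q Q∈M′ → covers Q (I-respʳ Q M′ M (∼ᵥ-sym M∼M′) Q∈M′))
    maps-invariant : ∀ M → Invariant (Maps M)
    maps-invariant M P P′ P∼P′ maps P′∈L =
      I-respˡ (f P) (f P′) M (cong π P P′ P∼P′) (maps (I-respˡ P′ P L (∼ᵥ-sym P∼P′) P′∈L))
    preimage-invariant : ∀ Q → Invariant (Preimage Q)
    preimage-invariant Q P P′ P∼P′ (P∈L , fP∼Q) =
      I-respˡ P P′ L P∼P′ P∈L , ∼ᵥ-trans (cong π P′ P (∼ᵥ-sym P∼P′)) fP∼Q
    covered-invariant : ∀ M → Invariant (Covered M)
    covered-invariant M Q Q′ Q∼Q′ covered Q′∈M =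
      let (P , P∈L , fP∼Q) = covered (I-respˡ Q′ Q M (∼ᵥ-sym Q∼Q′) Q′∈M) in P , P∈L , ∼ᵥ-trans fP∼Q Q∼Q′

  module ThroughTwoPoints (P : Point) (off-P-images : ∀ N → ¬ P I N → ImageIsLine π N)
                          (L : Line) (Q : Point) (P∈L : P I L) (Q∈L : Q I L) (Q≁P : ¬ Q ∼ P) where

    fP≁fQ : ¬ f P ∼ f Q
    fP≁fQ fP∼fQ = Q≁P (∼ᵥ-sym (injective π P Q fP∼fQ))

    M : Line
    M = join (f P) (f Q) fP≁fQ

    -- For Z off L the line QZ avoids P, so its image is a line: the only line K through f Q and f Z.
    -- All of K is then covered by images of points of QZ, which meets L only in Q.
    off-line-image : ∀ Z → ¬ Z I L → ∀ K → f Q I K → f Z I K → ∀ W → W I L → ¬ W ∼ Q → ¬ f W I K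
    off-line-image Z Z∉L K fQ∈K fZ∈K W W∈L W≁Q fW∈K = from-image (off-P-images N P∉N)
      where
      Q≁Z : ¬ Q ∼ Z
      Q≁Z Q∼Z = Z∉L (I-respˡ Q Z L Q∼Z Q∈L)
      N : Line
      N = join Q Z Q≁Z
      on-N⇒Z∈L : ∀ V → ¬ V ∼ Q → V I L → V I N → Z I L
      on-N⇒Z∈L V V≁Q V∈L V∈N =
        I-respʳ Z N L (line-unique V Q N L V≁Q V∈N (join-Iˡ Q Z Q≁Z) V∈L Q∈L) (join-Iʳ Q Z Q≁Z)
      P∉N : ¬ P I N
      P∉N P∈N = Z∉L (on-N⇒Z∈L P (λ P∼Q → Q≁P (∼ᵥ-sym P∼Q)) P∈L P∈N)
      from-image : ImageIsLine π N → ⊥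
      from-image (N′ , maps , covers) =
        let (X , X∈N , fX∼fW) = covers (f W) (I-respʳ (f W) K N′ K∼N′ fW∈K)
        in Z∉L (on-N⇒Z∈L W W≁Q W∈L (I-respˡ X W N (injective π X W fX∼fW) X∈N))
        where
        K∼N′ : K ∼ N′
        K∼N′ = line-unique (f Q) (f Z) K N′ (λ fQ∼fZ → Q≁Z (injective π Q Z fQ∼fZ))
                 fQ∈K fZ∈K (maps Q (join-Iˡ Q Z Q≁Z)) (maps Z (join-Iʳ Q Z Q≁Z))

    backward : ∀ Y → Y I M → ∃ λ X → X I L × f X ∼ Y
    backward Y Y∈M = on-L (surjective π Y)
      where
      on-L : ∃ (λ X → f X ∼ Y) → ∃ λ X → X I L × f X ∼ Y
      on-L (X , fX∼Y) with I? X L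
      ... | yes X∈L = X , X∈L , fX∼Y
      ... | no X∉L  = ⊥-elim (off-line-image X X∉L M (join-Iʳ (f P) (f Q) fP≁fQ)
                        (I-respˡ Y (f X) M (∼ᵥ-sym fX∼Y) Y∈M) P P∈L (λ P∼Q → Q≁P (∼ᵥ-sym P∼Q))
                        (join-Iˡ (f P) (f Q) fP≁fQ))

    -- If f X were off M, then by off-line-image the preimages of the q + 1 points of the line
    -- through f Q and f X would all lie on L and differ from P, but L has only q such points.
    image-not-off-M : ∀ X → X I L → ¬ ¬ f X I M
    image-not-off-M X X∈L fX∉M = by-cases (Fin.any? λ i → ¬? (I? (Z i) L))
      where
      fQ≁fX : ¬ f Q ∼ f X
      fQ≁fX fQ∼fX = fX∉M (I-respˡ (f Q) (f X) M fQ∼fX (join-Iʳ (f P) (f Q) fP≁fQ))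
      K : Line
      K = join (f Q) (f X) fQ≁fX
      fP∉K : ¬ f P I K
      fP∉K fP∈K = fX∉M (I-respʳ (f X) K M
        (line-unique (f P) (f Q) K M fP≁fQ fP∈K (join-Iˡ (f Q) (f X) fQ≁fX)
                     (join-Iˡ (f P) (f Q) fP≁fQ) (join-Iʳ (f P) (f Q) fP≁fQ))
        (join-Iʳ (f Q) (f X) fQ≁fX))
      W : Fin (suc q) → Point
      W = line-points (f Q) (f X) fQ≁fX
      Z : Fin (suc q) → Point
      Z i = proj₁ (surjective π (W i))
      fZ∼W : ∀ i → f (Z i) ∼ W i
      fZ∼W i = proj₂ (surjective π (W i))
      fZ∈K : ∀ i → f (Z i) I K
      fZ∈K i = I-respˡ (W i) (f (Z i)) K (∼ᵥ-sym (fZ∼W i))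
                 (line-points-I (f Q) (f X) fQ≁fX K (join-Iˡ (f Q) (f X) fQ≁fX) (join-Iʳ (f Q) (f X) fQ≁fX) i)
      Z≁P : ∀ i → ¬ Z i ∼ P
      Z≁P i Zi∼P = fP∉K (I-respˡ (f (Z i)) (f P) K (cong π (Z i) P Zi∼P) (fZ∈K i))
      Z-injective : Injective _≡_ _∼_ Z
      Z-injective {i} {j} Zi∼Zj = line-points-injective (f Q) (f X) fQ≁fX
        (∼ᵥ-trans (∼ᵥ-sym (fZ∼W i)) (∼ᵥ-trans (cong π (Z i) (Z j) Zi∼Zj) (fZ∼W j)))
      by-cases : Dec (∃ λ i → ¬ Z i I L) → ⊥
      by-cases (yes (i , Zi∉L)) = off-line-image (Z i) Zi∉L K (join-Iˡ (f Q) (f X) fQ≁fX) (fZ∈K i)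
        X X∈L (λ X∼Q → fQ≁fX (∼ᵥ-sym (cong π X Q X∼Q))) (join-Iʳ (f Q) (f X) fQ≁fX)
      by-cases (no none-off) = line-minus-point-notInjective P Q L Q≁P P∈L Q∈L Z
        (λ i → decidable-stable (I? (Z i) L) (λ Zi∉L → none-off (i , Zi∉L))) Z≁P Z-injective

    forward : ∀ X → X I L → f X I M
    forward X X∈L = decidable-stable (I? (f X) M) (image-not-off-M X X∈L)

  lines-off-point⇒collineation : ∀ P → (∀ N → ¬ P I N → ImageIsLine π N) → IsCollineation π
  lines-off-point⇒collineation P off-P-images L = by-cases (I? P L)
    where
    through : P I L → (∃ λ Q → Q I L × ¬ Q ∼ P) → ImageIsLine π L
    through P∈L (Q , Q∈L , Q≁P) = M , forward , backward
      where open ThroughTwoPoints P off-P-images L Q P∈L Q∈L Q≁P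
    by-cases : Dec (P I L) → ImageIsLine π L
    by-cases (yes P∈L) = through P∈L (other-point-on P L P∈L)
    by-cases (no P∉L)  = off-P-images L P∉L

  line-avoiding-with-non-line-image : ¬ IsCollineation π → ∀ P → ∃ λ L → ¬ P I L × ¬ ImageIsLine π L
  line-avoiding-with-non-line-image not-collineation P = decidable-stable
    (any-point? (λ L → ¬ P I L × ¬ ImageIsLine π L) invariant (λ L → ¬? (I? P L) ×-dec ¬? (ImageIsLine? L)))
    λ none → not-collineation (lines-off-point⇒collineation P λ N P∉N →
      decidable-stable (ImageIsLine? N) (λ not-line → none (N , P∉N , not-line)))
    where
    invariant : Invariant (λ L → ¬ P I L × ¬ ImageIsLine π L)
    invariant L L′ L∼L′ (P∉L , not-line) =
      (λ P∈L′ → P∉L (I-respʳ P L′ L (∼ᵥ-sym L∼L′) P∈L′)) ,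
      (λ line → not-line (ImageIsLine-invariant L′ L (∼ᵥ-sym L∼L′) line))

mainTheorem7 : (q : ℕ) → IsPrimePower q →
    (F : Field 0ℓ 0ℓ) → Inverse (Field.setoid F) (setoid (Fin q)) →
    (π : PG.PointPerm F) → ¬ PG.IsCollineation F π →
    ∃ λ L₁ → ∃ λ L₂ → ∃ λ L₃ →
    ¬ PG.ImageIsLine F π L₁ × ¬ PG.ImageIsLine F π L₂ × ¬ PG.ImageIsLine F π L₃ ×
    ¬ (∃ λ P → PG._I_ F P L₁ × PG._I_ F P L₂ × PG._I_ F P L₃)
mainTheorem7 q _ F F↔Fin π not-collineation =
  let (L₁ , _ , bad₁)     = line-avoiding-with-non-line-image not-collineation e₀
      (P₁ , P₁∈L₁)        = point-on L₁
      (L₃ , P₁∉L₃ , bad₃) = line-avoiding-with-non-line-image not-collineation P₁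
      L₁≁L₃               = λ L₁∼L₃ → P₁∉L₃ (I-respʳ P₁ L₁ L₃ L₁∼L₃ P₁∈L₁)
      (L₂ , R∉L₂ , bad₂)  = line-avoiding-with-non-line-image not-collineation (meet L₁ L₃ L₁≁L₃)
  in L₁ , L₂ , L₃ , bad₁ , bad₂ , bad₃ , non-concurrent L₁ L₂ L₃ L₁≁L₃ R∉L₂
  where
  open FinitePlane F F↔Fin
  open Collineations F F↔Fin π
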